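{- Let $p\geq 3$ and $n\geq 1$ be integers, and let $r\geq 1$ be the unique integer with $\binom{r+p-3}{p-2}\leq n<\binom{r+p-2}{p-2}$. Then $K(n,p)-K(n-1,p)$ is equal to either $2^{r}$ or $2^{r-1}$.
   Context: For integers $p\geq 3$ and $m\geq 0$, let $s\geq 0$ be the unique integer with $\binom{p+s-3}{p-2}\leq m<\binom{p+s-2}{p-2}$ (binomial coefficients $\binom{a}{b}$ with $a<b$ are $0$), and define $$K(m,p)=\sum_{t=0}^{s-1}2^{t}\binom{p+t-3}{p-3}+2^{s}\Big(m-\binom{p+s-3}{p-2}\Big).$$ (In particular $K(0,p)=0$.) -}

module Defs where

open import Data.Nat using (ℕ; zero; suc; _+_; _*_; _∸_; _^_; _≤ᵇ_)
open import Data.Nat.Combinatorics using (_C_)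
open import Data.Bool using (if_then_else_)

-- Note: stdlib's  a C b  is 0 when a < b, matching the paper's convention.

-- B p t = binom(p + t - 3, p - 2)   (used for p ≥ 3, so p + t - 3 is exact)
B : ℕ → ℕ → ℕ
B p t = (p + t ∸ 3) C (p ∸ 2)

-- sIdx m p = the largest s ≤ m+1 with B p s ≤ m (found by searching
-- downward from the bound m+1).  For p ≥ 3 the sequence B p t is 0 at t = 0
-- and strictly increasing for t ≥ 0 with B p t ≥ t, so this is the unique s
-- with B p s ≤ m < B p (s+1).
sFrom : ℕ → ℕ → ℕ → ℕ
sFrom m p zero = zero
sFrom m p (suc k) = if B p (suc k) ≤ᵇ m then suc k else sFrom m p k

sIdx : ℕ → ℕ → ℕ
sIdx m p = sFrom m p (suc m)

sumPart : ℕ → ℕ → ℕ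
sumPart p zero = zero
sumPart p (suc s) = sumPart p s + 2 ^ s * ((p + s ∸ 3) C (p ∸ 3))

K : ℕ → ℕ → ℕ
K m p = sumPart p (sIdx m p) + 2 ^ (sIdx m p) * (m ∸ B p (sIdx m p))

module Submission where

-- Write p = 3 + q.  The thresholds  B p t = binom(q+t, q+1)  satisfy Pascal's
-- rule  B p (t+1) = B p t + c t  with increment  c t = binom(q+t, q) ≥ 1,  so
-- they form a strictly increasing sequence starting at B p 0 = 0.  Hence the
-- index computed by  sIdx  is the unique s with  B p s ≤ m < B p (s+1)  (its
-- "band"), and inside band s the function K is the affine map
--   Kat p s m = sumPart p s + 2^s (m - B p s),
-- whose unit steps are exactly 2^s.  Since sumPart p (s+1) adds exactly
-- 2^s · c s, the affine maps of consecutive bands agree at the common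
-- boundary point B p (s+1): K is a continuous piecewise-linear function.
-- The theorem follows by looking at the step n-1 ↦ n: either both points lie
-- in band r (step 2^r), or n = B p r is the left end of band r, in which case
-- continuity lets us compute the step with the affine map of band r-1
-- (step 2^(r-1)).

open import Defs
open import Data.Nat using (ℕ; _+_; _≤_; _<_; _∸_; _^_)
open import Data.Sum using (_⊎_)
open import Relation.Binary.PropositionalEquality using (_≡_)

open import Data.Nat using (zero; suc; _*_; z≤n; s≤s; s≤s⁻¹; _≤ᵇ_)
open import Data.Nat.Properties
open import Data.Nat.Combinatorics using (_C_; nCk+nC[k+1]≡[n+1]C[k+1])
open import Data.Sum using (inj₁; inj₂)
open import Data.Bool using (true; false; T)
open import Relation.Binary.PropositionalEquality
  using (_≢_; refl; sym; cong; cong₂; subst; module ≡-Reasoning)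
open import Relation.Nullary using (yes; no; contradiction)

C-pos : ∀ n k → k ≤ n → 1 ≤ n C k
C-pos n       zero    _         = ≤-refl
C-pos (suc n) (suc k) (s≤s k≤n) =
  subst (1 ≤_) (nCk+nC[k+1]≡[n+1]C[k+1] n k) (≤-trans (C-pos n k k≤n) (m≤m+n _ _))

B-succ : ∀ q t → B (3 + q) (suc t) ≡ B (3 + q) t + (q + t) C q
B-succ q t = begin
  (q + suc t) C suc q               ≡⟨ cong (_C suc q) (+-suc q t) ⟩
  suc (q + t) C suc q               ≡⟨ sym (nCk+nC[k+1]≡[n+1]C[k+1] (q + t) q) ⟩
  (q + t) C q + (q + t) C suc q     ≡⟨ +-comm ((q + t) C q) ((q + t) C suc q) ⟩
  B (3 + q) t + (q + t) C q         ∎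
  where open ≡-Reasoning

B-increasing : ∀ q t → B (3 + q) t < B (3 + q) (suc t)
B-increasing q t = subst (B (3 + q) t <_) (sym (B-succ q t))
  (subst (_≤ B (3 + q) t + (q + t) C q) (+-comm (B (3 + q) t) 1)
    (+-monoʳ-≤ (B (3 + q) t) (C-pos (q + t) q (m≤m+n q t))))

B-mono : ∀ q {s t} → s ≤ t → B (3 + q) s ≤ B (3 + q) t
B-mono q {t = zero}  z≤n = ≤-refl
B-mono q {t = suc t} s≤1+t with m≤n⇒m<n∨m≡n s≤1+t
... | inj₂ refl        = ≤-refl
... | inj₁ (s≤s s≤t)   = ≤-trans (B-mono q s≤t) (<⇒≤ (B-increasing q t))

B-reflects-< : ∀ q {s t} → B (3 + q) s < B (3 + q) t → s < t
B-reflects-< q {s} {t} Bs<Bt with s <? t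
... | yes s<t = s<t
... | no  s≮t = contradiction (B-mono q (≮⇒≥ s≮t)) (<⇒≱ Bs<Bt)

-- A strictly increasing sequence from 0 dominates the identity; this bounds
-- the band index of m by m, so the search in sIdx starts high enough.
B-unbounded : ∀ q t → t ≤ B (3 + q) t
B-unbounded q zero    = z≤n
B-unbounded q (suc t) = ≤-trans (s≤s (B-unbounded q t)) (B-increasing q t)

sFrom-band : ∀ q m r k → B (3 + q) r ≤ m → m < B (3 + q) (suc r) → r ≤ k →
             sFrom m (3 + q) k ≡ r
sFrom-band q m zero    zero    _  _  _ = refl
sFrom-band q m (suc r) zero    _  _  ()
sFrom-band q m r       (suc k) lo hi r≤1+k with B (3 + q) (suc k) ≤ᵇ m in test
... | true  = ≤-antisym (s≤s⁻¹ (B-reflects-< q (≤-<-trans (≤ᵇ⇒≤ _ _ (subst T (sym test) _)) hi))) r≤1+k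
... | false = sFrom-band q m r k lo hi (s≤s⁻¹ (≤∧≢⇒< r≤1+k r≢1+k))
  where
  r≢1+k : r ≢ suc k
  r≢1+k refl = subst T test (≤⇒≤ᵇ lo)

sIdx-band : ∀ q m s → B (3 + q) s ≤ m → m < B (3 + q) (suc s) → sIdx m (3 + q) ≡ s
sIdx-band q m s lo hi =
  sFrom-band q m s (suc m) lo hi (≤-trans (B-unbounded q s) (≤-trans lo (n≤1+n m)))

Kat : ℕ → ℕ → ℕ → ℕ
Kat p s m = sumPart p s + 2 ^ s * (m ∸ B p s)

K-band : ∀ q m s → B (3 + q) s ≤ m → m < B (3 + q) (suc s) → K m (3 + q) ≡ Kat (3 + q) s m
K-band q m s lo hi = cong (λ i → Kat (3 + q) i m) (sIdx-band q m s lo hi)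

Kat-step : ∀ p s m → B p s ≤ m → Kat p s (suc m) ∸ Kat p s m ≡ 2 ^ s
Kat-step p s m lo = begin
  Kat p s (suc m) ∸ Kat p s m
    ≡⟨ [m+n]∸[m+o]≡n∸o (sumPart p s) (2 ^ s * (suc m ∸ B p s)) (2 ^ s * (m ∸ B p s)) ⟩
  2 ^ s * (suc m ∸ B p s) ∸ 2 ^ s * (m ∸ B p s)
    ≡⟨ cong (λ x → 2 ^ s * x ∸ 2 ^ s * (m ∸ B p s)) (+-∸-assoc 1 lo) ⟩
  2 ^ s * suc (m ∸ B p s) ∸ 2 ^ s * (m ∸ B p s)
    ≡⟨ cong (_∸ 2 ^ s * (m ∸ B p s)) (*-suc (2 ^ s) (m ∸ B p s)) ⟩
  2 ^ s + 2 ^ s * (m ∸ B p s) ∸ 2 ^ s * (m ∸ B p s)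
    ≡⟨ m+n∸n≡m (2 ^ s) (2 ^ s * (m ∸ B p s)) ⟩
  2 ^ s ∎
  where open ≡-Reasoning

-- Continuity: the affine maps of bands s and s+1 agree at B p (s+1), because
-- sumPart p (s+1) adds exactly 2^s times the increment binom(q+s, q).
Kat-continuous : ∀ q s → Kat (3 + q) (suc s) (B (3 + q) (suc s)) ≡ Kat (3 + q) s (B (3 + q) (suc s))
Kat-continuous q s = begin
  sumPart p s + 2 ^ s * c + 2 ^ suc s * (B p (suc s) ∸ B p (suc s))
    ≡⟨ cong (λ x → sumPart p s + 2 ^ s * c + 2 ^ suc s * x) (n∸n≡0 (B p (suc s))) ⟩
  sumPart p s + 2 ^ s * c + 2 ^ suc s * 0
    ≡⟨ cong (sumPart p s + 2 ^ s * c +_) (*-zeroʳ (2 ^ suc s)) ⟩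
  sumPart p s + 2 ^ s * c + 0
    ≡⟨ +-identityʳ _ ⟩
  sumPart p s + 2 ^ s * c
    ≡⟨ cong (λ x → sumPart p s + 2 ^ s * x) (sym (m+n∸m≡n (B p s) c)) ⟩
  sumPart p s + 2 ^ s * (B p s + c ∸ B p s)
    ≡⟨ cong (λ x → sumPart p s + 2 ^ s * (x ∸ B p s)) (sym (B-succ q s)) ⟩
  sumPart p s + 2 ^ s * (B p (suc s) ∸ B p s) ∎
  where
  open ≡-Reasoning
  p = 3 + q
  c = (q + s) C q

K-step-inside : ∀ q m s → B (3 + q) s ≤ m → suc m < B (3 + q) (suc s) →
                K (suc m) (3 + q) ∸ K m (3 + q) ≡ 2 ^ s
K-step-inside q m s lo hi = begin
  K (suc m) p ∸ K m p
    ≡⟨ cong₂ _∸_ (K-band q (suc m) s (m≤n⇒m≤1+n lo) hi) (K-band q m s lo (<-trans (n<1+n m) hi)) ⟩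
  Kat p s (suc m) ∸ Kat p s m
    ≡⟨ Kat-step p s m lo ⟩
  2 ^ s ∎
  where
  open ≡-Reasoning
  p = 3 + q

-- A step onto the left end m+1 = B p (s+1) of band s+1 has size 2^s: by
-- continuity both values are computed by the affine map of band s.
K-step-boundary : ∀ q m s → B (3 + q) (suc s) ≡ suc m →
                  K (suc m) (3 + q) ∸ K m (3 + q) ≡ 2 ^ s
K-step-boundary q m s edge = begin
  K (suc m) p ∸ K m p
    ≡⟨ cong₂ _∸_ (K-band q (suc m) (suc s) (≤-reflexive edge) above) (K-band q m s below m<edge) ⟩
  Kat p (suc s) (suc m) ∸ Kat p s m
    ≡⟨ cong (λ x → Kat p (suc s) x ∸ Kat p s m) (sym edge) ⟩
  Kat p (suc s) (B p (suc s)) ∸ Kat p s m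
    ≡⟨ cong (_∸ Kat p s m) (Kat-continuous q s) ⟩
  Kat p s (B p (suc s)) ∸ Kat p s m
    ≡⟨ cong (λ x → Kat p s x ∸ Kat p s m) edge ⟩
  Kat p s (suc m) ∸ Kat p s m
    ≡⟨ Kat-step p s m below ⟩
  2 ^ s ∎
  where
  open ≡-Reasoning
  p = 3 + q
  m<edge : m < B p (suc s)
  m<edge = subst (m <_) (sym edge) (n<1+n m)
  below : B p s ≤ m
  below = s≤s⁻¹ (subst (B p s <_) edge (B-increasing q s))
  above : suc m < B p (suc (suc s))
  above = subst (_< B p (suc (suc s))) edge (B-increasing q (suc s))

lemma4p1 : (p n r : ℕ) → 3 ≤ p → 1 ≤ n → 1 ≤ r →
    B p r ≤ n → n < B p (r + 1) →
    (K n p ∸ K (n ∸ 1) p ≡ 2 ^ r) ⊎ (K n p ∸ K (n ∸ 1) p ≡ 2 ^ (r ∸ 1))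
lemma4p1 (suc (suc (suc q))) (suc m) r (s≤s (s≤s (s≤s _))) _ _ lo hi with m≤n⇒m<n∨m≡n lo
... | inj₁ (s≤s lo′) = inj₁ (K-step-inside q m r lo′ (subst (λ i → suc m < B (3 + q) i) (+-comm r 1) hi))
lemma4p1 (suc (suc (suc q))) (suc m) (suc s) (s≤s (s≤s (s≤s _))) _ (s≤s _) lo hi | inj₂ edge = inj₂ (K-step-boundary q m s edge)
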